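{- Let $p$ be a prime and define sets $Q_p^0,Q_p^1,\dots\subset[0,1]$ by $Q_p^0=\{0,1\}$ and $Q_p^{i+1}=Q_p^i\cup\{\frac{\lceil p/2\rceil}{p}\alpha,\ 1-\frac{\lceil p/2\rceil}{p}\alpha : \alpha\in Q_p^i\}$. For $i\ge 0$ let $$g_i=\max\{d\in\mathbb{R}: \exists\,\alpha\in[0,1]\text{ such that } (\alpha-d/2,\alpha+d/2)\cap Q_p^i=\emptyset\}.$$ Then for every $i\ge 1$, $g_i\le g_{i-1}\cdot\frac{\lceil p/2\rceil}{p}$.
   Formalization: The numbers d and α in the definition of $g_i$, and the values $g_i$ themselves, are taken in ℚ rather than ℝ. -}

module Defs where

open import Data.Nat as ℕ using (ℕ; zero; suc; ⌈_/2⌉; NonZero)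
open import Data.Integer using (+_)
open import Data.Rational using (ℚ; _/_; 0ℚ; 1ℚ; ½; _*_; _+_; _-_; _<_; _≤_)
open import Data.List using (List; []; _∷_; _++_; map)
open import Data.List.Membership.Propositional using (_∈_)
open import Data.Product using (Σ; _×_; ∃)
open import Relation.Nullary using (¬_)

ratio : (p : ℕ) .{{_ : NonZero p}} → ℚ
ratio p = (+ ⌈ p /2⌉) / p

-- Q_p^i as a finite list of rationals (membership = set membership)
Q : (p : ℕ) .{{_ : NonZero p}} → ℕ → List ℚ
Q p zero = 0ℚ ∷ 1ℚ ∷ []
Q p (suc i) = Q p i ++ (map (λ α → ratio p * α) (Q p i) ++ map (λ α → 1ℚ - ratio p * α) (Q p i))

IsGap : List ℚ → ℚ → Set
IsGap S d = ∃ λ α → (0ℚ ≤ α) × (α ≤ 1ℚ) ×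
  (∀ q → q ∈ S → ¬ ((α - d * ½ < q) × (q < α + d * ½)))

IsMaxGap : List ℚ → ℚ → Set
IsMaxGap S g = IsGap S g × (∀ d → IsGap S d → d ≤ g)

-- Write r = ⌈p/2⌉/p, so r ≥ ½. The maps x ↦ r x and x ↦ 1 - r x send Q_p^i into
-- Q_p^{i+1}. Let (α - d/2, α + d/2) be a gap of Q_p^{i+1} with α ∈ [0,1]. Since r ≥ ½,
-- either α ≤ r or 1 - α ≤ r; in the first case the preimage of the gap under x ↦ r x,
-- in the second its preimage under x ↦ 1 - r x, is a gap of Q_p^i of width d / r
-- centred in [0,1]. Hence g_{i+1} / r ≤ g_i.
module Submission where

open import Defs
open import Data.Nat as ℕ using (ℕ; zero; suc; ⌈_/2⌉; NonZero)
open import Data.Nat.Primality using (Prime)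
open import Data.Integer as ℤ using (+_)
open import Data.Rational using (ℚ; _*_; _≤_; _+_; _-_; -_; _<_; 0ℚ; 1ℚ; ½; Positive; 1/_) renaming (NonZero to NonZeroℚ)
open import Data.Rational.Properties
open import Data.Rational.Solver using (module +-*-Solver)
import Data.Rational.Unnormalised as ℚᵘ
import Data.Rational.Unnormalised.Properties as ℚᵘ
import Data.Nat.Properties as ℕ
open import Data.Product using (_,_; _×_)
open import Data.List using (map)
open import Data.List.Membership.Propositional using (_∈_)
open import Data.List.Membership.Propositional.Properties using (∈-map⁺; ∈-++⁺ˡ; ∈-++⁺ʳ)
open import Relation.Binary.PropositionalEquality using (_≡_; refl; trans; cong; subst; subst₂; module ≡-Reasoning)
open import Relation.Nullary using (yes; no)

open +-*-Solver

-- The open interval of width (not radius) d centred at α, as in IsGap.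
Ball : ℚ → ℚ → ℚ → Set
Ball α d q = (α - d * ½ < q) × (q < α + d * ½)

Ball-reflect : ∀ α d {q} → Ball (1ℚ - α) d q → Ball α d (1ℚ - q)
Ball-reflect α d {q} (lower , upper) =
  ( subst (_< 1ℚ - q) (1-[1-a+b]≡a-b α (d * ½)) (1-mono upper)
  , subst (1ℚ - q <_) (1-[1-a-b]≡a+b α (d * ½)) (1-mono lower) )
  where
  1-mono : ∀ {x y} → x < y → 1ℚ - y < 1ℚ - x
  1-mono x<y = +-monoʳ-< 1ℚ (neg-antimono-< x<y)
  1-[1-a+b]≡a-b : ∀ a b → 1ℚ - ((1ℚ - a) + b) ≡ a - b
  1-[1-a+b]≡a-b = solve 2 (λ a b → con 1ℚ :- ((con 1ℚ :- a) :+ b) := a :- b) refl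
  1-[1-a-b]≡a+b : ∀ a b → 1ℚ - ((1ℚ - a) - b) ≡ a + b
  1-[1-a-b]≡a+b = solve 2 (λ a b → con 1ℚ :- ((con 1ℚ :- a) :- b) := a :+ b) refl

Ball-scale : ∀ r .{{_ : Positive r}} {β e q} → Ball β e q → Ball (r * β) (r * e) (r * q)
Ball-scale r {β} {e} {q} (lower , upper) =
  ( subst (_< r * q) (*-distribˡ-lower r β e) (*-monoʳ-<-pos r lower)
  , subst (r * q <_) (*-distribˡ-upper r β e) (*-monoʳ-<-pos r upper) )
  where
  *-distribˡ-lower : ∀ r b w → r * (b - w * ½) ≡ r * b - (r * w) * ½
  *-distribˡ-lower = solve 3 (λ r b w → r :* (b :- w :* con ½) := r :* b :- (r :* w) :* con ½) refl
  *-distribˡ-upper : ∀ r b w → r * (b + w * ½) ≡ r * b + (r * w) * ½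
  *-distribˡ-upper = solve 3 (λ r b w → r :* (b :+ w :* con ½) := r :* b :+ (r :* w) :* con ½) refl

module Contraction (r : ℚ) .{{_ : Positive r}} where

  instance
    r≢0 : NonZeroℚ r
    r≢0 = pos⇒nonZero r

  r⁻¹ : ℚ
  r⁻¹ = 1/ r

  instance
    r⁻¹>0 : Positive r⁻¹
    r⁻¹>0 = 1/pos⇒pos r

  *r⁻¹*r : ∀ x → x * r⁻¹ * r ≡ x
  *r⁻¹*r x = begin
    x * r⁻¹ * r   ≡⟨ *-assoc x r⁻¹ r ⟩
    x * (r⁻¹ * r) ≡⟨ cong (x *_) (*-inverseˡ r) ⟩
    x * 1ℚ        ≡⟨ *-identityʳ x ⟩
    x             ∎
    where open ≡-Reasoning

  r*[*r⁻¹] : ∀ x → r * (x * r⁻¹) ≡ x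
  r*[*r⁻¹] x = trans (*-comm r (x * r⁻¹)) (*r⁻¹*r x)

  0≤*r⁻¹ : ∀ {x} → 0ℚ ≤ x → 0ℚ ≤ x * r⁻¹
  0≤*r⁻¹ {x} 0≤x = subst (_≤ x * r⁻¹) (*-zeroˡ r⁻¹) (*-monoʳ-≤-nonNeg r⁻¹ {{pos⇒nonNeg r⁻¹}} 0≤x)

  *r⁻¹≤1 : ∀ {x} → x ≤ r → x * r⁻¹ ≤ 1ℚ
  *r⁻¹≤1 {x} x≤r = subst (x * r⁻¹ ≤_) (*-inverseʳ r) (*-monoʳ-≤-nonNeg r⁻¹ {{pos⇒nonNeg r⁻¹}} x≤r)

  Ball-contract : ∀ β d {q} → Ball (β * r⁻¹) (d * r⁻¹) q → Ball β d (r * q)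
  Ball-contract β d {q} q∈Ball =
    subst₂ (λ a w → Ball a w (r * q)) (r*[*r⁻¹] β) (r*[*r⁻¹] d) (Ball-scale r q∈Ball)

  IsGap-contract : ∀ {S T d} → ½ ≤ r →
    (∀ {q} → q ∈ S → r * q ∈ T) → (∀ {q} → q ∈ S → 1ℚ - r * q ∈ T) →
    IsGap T d → IsGap S (d * r⁻¹)
  IsGap-contract {d = d} ½≤r r*S⊆T 1-r*S⊆T (α , 0≤α , α≤1 , T∌Ball) with α ≤? r
  ... | yes α≤r =
    α * r⁻¹ , 0≤*r⁻¹ 0≤α , *r⁻¹≤1 α≤r , λ q q∈S q∈Ball →
      T∌Ball (r * q) (r*S⊆T q∈S) (Ball-contract α d q∈Ball)
  ... | no α≰r =
    (1ℚ - α) * r⁻¹ , 0≤*r⁻¹ 0≤1-α , *r⁻¹≤1 1-α≤r , λ q q∈S q∈Ball →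
      T∌Ball (1ℚ - r * q) (1-r*S⊆T q∈S) (Ball-reflect α d (Ball-contract (1ℚ - α) d q∈Ball))
    where
    0≤1-α : 0ℚ ≤ 1ℚ - α
    0≤1-α = subst (_≤ 1ℚ - α) (+-inverseʳ α) (+-monoˡ-≤ (- α) α≤1)
    1-α≤r : 1ℚ - α ≤ r
    1-α≤r = ≤-trans (+-monoʳ-≤ 1ℚ (neg-antimono-≤ (≤-trans ½≤r (<⇒≤ (≰⇒> α≰r))))) ½≤r

  IsMaxGap-contract : ∀ {S T g₁ g} → ½ ≤ r →
    (∀ {q} → q ∈ S → r * q ∈ T) → (∀ {q} → q ∈ S → 1ℚ - r * q ∈ T) →
    IsMaxGap T g₁ → IsMaxGap S g → g₁ ≤ g * r
  IsMaxGap-contract {g₁ = g₁} {g} ½≤r r*S⊆T 1-r*S⊆T (g₁-gap , _) (_ , g-max) =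
    subst (_≤ g * r) (*r⁻¹*r g₁)
      (*-monoʳ-≤-nonNeg r {{pos⇒nonNeg r}} (g-max (g₁ * r⁻¹) (IsGap-contract {d = g₁} ½≤r r*S⊆T 1-r*S⊆T g₁-gap)))

n≤⌈n/2⌉*2 : ∀ n → n ℕ.≤ ⌈ n /2⌉ ℕ.* 2
n≤⌈n/2⌉*2 zero          = ℕ.z≤n
n≤⌈n/2⌉*2 (suc zero)    = ℕ.s≤s ℕ.z≤n
n≤⌈n/2⌉*2 (suc (suc n)) = ℕ.s≤s (ℕ.s≤s (n≤⌈n/2⌉*2 n))

ratio-pos : ∀ p .{{_ : NonZero p}} → Positive (ratio p)
ratio-pos (suc k) = normalize-pos ⌈ suc k /2⌉ (suc k)

½≤ratio : ∀ p .{{_ : NonZero p}} → ½ ≤ ratio p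
½≤ratio (suc k) = toℚᵘ-cancel-≤
  (ℚᵘ.≤-respʳ-≃ (ℚᵘ.≃-sym (toℚᵘ-fromℚᵘ (ℚᵘ.mkℚᵘ (+ ⌈ suc k /2⌉) k)))
    (ℚᵘ.*≤* (ℤ.+≤+ (ℕ.≤-trans (ℕ.≤-reflexive (ℕ.*-identityˡ (suc k))) (n≤⌈n/2⌉*2 (suc k))))))

module _ (p : ℕ) .{{_ : NonZero p}} where

  ratio*∈Q : ∀ i {q} → q ∈ Q p i → ratio p * q ∈ Q p (suc i)
  ratio*∈Q i q∈Q = ∈-++⁺ʳ (Q p i) (∈-++⁺ˡ (∈-map⁺ (ratio p *_) q∈Q))

  1-ratio*∈Q : ∀ i {q} → q ∈ Q p i → 1ℚ - ratio p * q ∈ Q p (suc i)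
  1-ratio*∈Q i q∈Q = ∈-++⁺ʳ (Q p i) (∈-++⁺ʳ (map (ratio p *_) (Q p i)) (∈-map⁺ (λ α → 1ℚ - ratio p * α) q∈Q))

lemma4p5 : (p : ℕ) .{{_ : NonZero p}} → Prime p →
    (i : ℕ) (gᵢ₊₁ gᵢ : ℚ) →
    IsMaxGap (Q p (suc i)) gᵢ₊₁ → IsMaxGap (Q p i) gᵢ →
    gᵢ₊₁ ≤ gᵢ * ratio p
lemma4p5 p _ i gᵢ₊₁ gᵢ =
  Contraction.IsMaxGap-contract (ratio p) {{ratio-pos p}} (½≤ratio p) (ratio*∈Q p i) (1-ratio*∈Q p i)
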